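{- Let $\lesssim$ be a plausible preorder on $\mathcal{T}$, let $n\ge1$, and let $A_1,\dots,A_n$ be events. Then \[\bigvee_{i=1}^n A_i\lesssim\sum_{i=1}^n A_i.\]
   Context: Random quantities: $\mathcal{T}$ is a unital associative commutative algebra over $\mathbb{R}$; reals $r$ are identified with $r\mathbf{1}$; products are written $X.Y$. Events: idempotents $A$ ($A.A=A$). Disjunction of events is $A\vee B=A+B-A.B$. Plausible preorder: a relation $\lesssim$ on $\mathcal{T}$ with (i) $0\lesssim A$ for every event $A$; (ii) $0\lesssim X$ and $0\lesssim Y$ imply $0\lesssim X+Y$; (iii) $0\lesssim X$ and real $q\ge0$ imply $0\lesssim qX$; (iv) $X\lesssim Y$ iff $0\lesssim Y-X$. -}

module Defs where

open import Level using (Level; _⊔_) renaming (suc to lsuc)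
open import Relation.Binary.PropositionalEquality using (_≡_)
open import Algebra.Bundles using (CommutativeRing)
open import Algebra.Structures using (IsCommutativeRing)
open import Data.Nat using (ℕ) renaming (suc to sucℕ)
open import Data.Fin using (Fin; zero; suc)

-- The scalar field ℝ is not available in agda-stdlib; we abstract it as an
-- arbitrary commutative ring of scalars S with a (total-order-free) relation ≤ₛ
-- on scalars, used only in axiom (iii).  A "random quantity algebra" 𝒯 over S is
-- a unital associative commutative ring (equality = _≡_) with a scalar action
-- that is an algebra map  r ↦ r·𝟏 ; reals are identified with r·𝟏.
record Scalars (a : Level) : Set (lsuc a) where
  field
    S    : Set a
    _+ₛ_ _*ₛ_ : S → S → S
    -ₛ_  : S → S
    0ₛ 1ₛ : S
    isCR : IsCommutativeRing _≡_ _+ₛ_ _*ₛ_ -ₛ_ 0ₛ 1ₛ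
    _≤ₛ_ : S → S → Set a

record Algebra {a} (K : Scalars a) (t : Level) : Set (a ⊔ lsuc t) where
  open Scalars K
  field
    T    : Set t
    _+_ _∙_ : T → T → T
    -_   : T → T
    𝟎 𝟏  : T
    isCR : IsCommutativeRing _≡_ _+_ _∙_ -_ 𝟎 𝟏
    _·_  : S → T → T
    ·-distribˡ : ∀ r X Y → r · (X + Y) ≡ (r · X) + (r · Y)
    ·-distribʳ : ∀ r s X → (r +ₛ s) · X ≡ (r · X) + (s · X)
    ·-assoc    : ∀ r s X → (r *ₛ s) · X ≡ r · (s · X)
    ·-identity : ∀ X → 1ₛ · X ≡ X
    ·-∙        : ∀ r X Y → r · (X ∙ Y) ≡ X ∙ (r · Y)

  ι : S → T
  ι r = r · 𝟏

  _−_ : T → T → T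
  X − Y = X + (- Y)

  IsEvent : T → Set t
  IsEvent A = A ∙ A ≡ A

  _∨_ : T → T → T
  A ∨ B = (A + B) − (A ∙ B)

  -- ⋁_{i=1}^n A_i and ∑_{i=1}^n A_i for n ≥ 1, indices Fin (suc n)
  ⋁ : ∀ n → (Fin (sucℕ n) → T) → T
  ⋁ ℕ.zero    A = A zero
  ⋁ (sucℕ n) A = A zero ∨ ⋁ n (λ i → A (suc i))

  ∑ : ∀ n → (Fin (sucℕ n) → T) → T
  ∑ ℕ.zero    A = A zero
  ∑ (sucℕ n) A = A zero + ∑ n (λ i → A (suc i))

  record PlausiblePreorder (ℓ : Level) : Set (a ⊔ t ⊔ lsuc ℓ) where
    field
      _≲_   : T → T → Set ℓ
      event-nonneg : ∀ A → IsEvent A → 𝟎 ≲ A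
      add-nonneg   : ∀ X Y → 𝟎 ≲ X → 𝟎 ≲ Y → 𝟎 ≲ (X + Y)
      scale-nonneg : ∀ X q → 𝟎 ≲ X → 0ₛ ≤ₛ q → 𝟎 ≲ (q · X)
      ≲-iff-l      : ∀ X Y → X ≲ Y → 𝟎 ≲ (Y − X)
      ≲-iff-r      : ∀ X Y → 𝟎 ≲ (Y − X) → X ≲ Y

-- Subtracting the disjunction from the sum telescopes,
--   (A + S) − (A ∨ B) = (S − B) + A ∙ B,
-- so ∑ A − ⋁ A is a sum of products A₀ ∙ ⋁ (A₁ … Aₖ), each an event and hence
-- plausibly nonnegative.  That ⋁ of events is an event comes from the disjoint
-- decomposition A ∨ B = A + (𝟏 − A) ∙ B.
module Submission where

open import Defs
open import Level using (Level)
open import Data.Nat using (ℕ; zero; suc)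
open import Data.Fin using (Fin)
import Data.Fin as Fin
open import Data.Maybe using (nothing)
open import Algebra.Bundles using (CommutativeRing)
import Algebra.Properties.Group as GroupProperties
import Algebra.Properties.Quasigroup as QuasigroupProperties
import Algebra.Properties.Ring as RingProperties
import Algebra.Solver.Ring.NaturalCoefficients as NaturalCoefficientsSolver
open import Relation.Binary.PropositionalEquality
  using (_≡_; refl; sym; cong; cong₂; subst; module ≡-Reasoning)

module Events {a t : Level} {K : Scalars a} (𝒯 : Algebra K t) where
  open Algebra 𝒯
  open ≡-Reasoning

  commutativeRing : CommutativeRing t t
  commutativeRing = record
    { Carrier = T ; _≈_ = _≡_ ; _+_ = _+_ ; _*_ = _∙_ ; -_ = -_ ; 0# = 𝟎 ; 1# = 𝟏
    ; isCommutativeRing = isCR }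

  private
    module R = CommutativeRing commutativeRing
    open RingProperties R.ring using (x[y-z]≈xy-xz; -0#≈0#; -‿distribˡ-*)
    open QuasigroupProperties (GroupProperties.quasigroup R.+-group) using (x≈z//y)
    -- Coefficients in T do not compute, so the ring solver cannot cancel x − x;
    -- the semiring solver with ℕ coefficients is used, negated terms as atoms.
    open NaturalCoefficientsSolver R.commutativeSemiring (λ _ _ → nothing)
      using (solve; _:+_; _:*_; _:=_)

  x−x≡𝟎 : ∀ X → X − X ≡ 𝟎
  x−x≡𝟎 = R.-‿inverseʳ

  𝟎-event : IsEvent 𝟎
  𝟎-event = R.zeroˡ 𝟎

  ∙-event : ∀ {A B} → IsEvent A → IsEvent B → IsEvent (A ∙ B)
  ∙-event {A} {B} eA eB = begin
    (A ∙ B) ∙ (A ∙ B) ≡⟨ solve 2 (λ A B → (A :* B) :* (A :* B) := (A :* A) :* (B :* B)) refl A B ⟩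
    (A ∙ A) ∙ (B ∙ B) ≡⟨ cong₂ _∙_ eA eB ⟩
    A ∙ B             ∎

  event∙complement≡𝟎 : ∀ {A} → IsEvent A → A ∙ (𝟏 − A) ≡ 𝟎
  event∙complement≡𝟎 {A} eA = begin
    A ∙ (𝟏 − A)       ≡⟨ x[y-z]≈xy-xz A 𝟏 A ⟩
    (A ∙ 𝟏) − (A ∙ A) ≡⟨ cong₂ _−_ (R.*-identityʳ A) eA ⟩
    A − A             ≡⟨ x−x≡𝟎 A ⟩
    𝟎                 ∎

  complement-event : ∀ {A} → IsEvent A → IsEvent (𝟏 − A)
  complement-event {A} eA = begin
    (𝟏 − A) ∙ (𝟏 − A)             ≡⟨ x[y-z]≈xy-xz (𝟏 − A) 𝟏 A ⟩
    ((𝟏 − A) ∙ 𝟏) − ((𝟏 − A) ∙ A) ≡⟨ cong₂ _−_ (R.*-identityʳ (𝟏 − A)) (R.*-comm (𝟏 − A) A) ⟩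
    (𝟏 − A) − (A ∙ (𝟏 − A))       ≡⟨ cong (λ X → (𝟏 − A) − X) (event∙complement≡𝟎 eA) ⟩
    (𝟏 − A) − 𝟎                   ≡⟨ cong ((𝟏 − A) +_) -0#≈0# ⟩
    (𝟏 − A) + 𝟎                   ≡⟨ R.+-identityʳ (𝟏 − A) ⟩
    𝟏 − A                         ∎

  disjoint-+-event : ∀ {A C} → IsEvent A → IsEvent C → A ∙ C ≡ 𝟎 → IsEvent (A + C)
  disjoint-+-event {A} {C} eA eC A∙C≡𝟎 = begin
    (A + C) ∙ (A + C)
      ≡⟨ solve 2 (λ A C → (A :+ C) :* (A :+ C) := ((A :* A) :+ (C :* C)) :+ ((A :* C) :+ (A :* C))) refl A C ⟩
    ((A ∙ A) + (C ∙ C)) + ((A ∙ C) + (A ∙ C))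
      ≡⟨ cong₂ _+_ (cong₂ _+_ eA eC) (cong₂ _+_ A∙C≡𝟎 A∙C≡𝟎) ⟩
    (A + C) + (𝟎 + 𝟎)
      ≡⟨ cong ((A + C) +_) (R.+-identityˡ 𝟎) ⟩
    (A + C) + 𝟎
      ≡⟨ R.+-identityʳ (A + C) ⟩
    A + C
      ∎

  ∨≡+[𝟏−A]∙B : ∀ A B → A ∨ B ≡ A + ((𝟏 − A) ∙ B)
  ∨≡+[𝟏−A]∙B A B = sym (begin
    A + ((𝟏 − A) ∙ B)           ≡⟨ cong (A +_) (R.distribʳ B 𝟏 (- A)) ⟩
    A + ((𝟏 ∙ B) + ((- A) ∙ B)) ≡⟨ cong₂ (λ X Y → A + (X + Y)) (R.*-identityˡ B) (sym (-‿distribˡ-* A B)) ⟩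
    A + (B − (A ∙ B))           ≡⟨ sym (R.+-assoc A B (- (A ∙ B))) ⟩
    A ∨ B                       ∎)

  ∨-event : ∀ {A B} → IsEvent A → IsEvent B → IsEvent (A ∨ B)
  ∨-event {A} {B} eA eB = subst IsEvent (sym (∨≡+[𝟏−A]∙B A B))
    (disjoint-+-event eA (∙-event (complement-event eA) eB) (begin
      A ∙ ((𝟏 − A) ∙ B) ≡⟨ sym (R.*-assoc A (𝟏 − A) B) ⟩
      (A ∙ (𝟏 − A)) ∙ B ≡⟨ cong (_∙ B) (event∙complement≡𝟎 eA) ⟩
      𝟎 ∙ B             ≡⟨ R.zeroˡ B ⟩
      𝟎                 ∎))

  [A+S]−[A∨B]≡[S−B]+A∙B : ∀ A S B → (A + S) − (A ∨ B) ≡ (S − B) + (A ∙ B)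
  [A+S]−[A∨B]≡[S−B]+A∙B A S B = sym (x≈z//y ((S − B) + W) (A ∨ B) (A + S) (begin
    ((S − B) + W) + ((A + B) − W)
      ≡⟨ solve 6 (λ S nB W A B nW → ((S :+ nB) :+ W) :+ ((A :+ B) :+ nW)
                                    := (A :+ S) :+ ((B :+ nB) :+ (W :+ nW)))
                 refl S (- B) W A B (- W) ⟩
    (A + S) + ((B − B) + (W − W))
      ≡⟨ cong₂ (λ X Y → (A + S) + (X + Y)) (x−x≡𝟎 B) (x−x≡𝟎 W) ⟩
    (A + S) + (𝟎 + 𝟎)
      ≡⟨ cong ((A + S) +_) (R.+-identityˡ 𝟎) ⟩
    (A + S) + 𝟎
      ≡⟨ R.+-identityʳ (A + S) ⟩
    A + S
      ∎))
    where W = A ∙ B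

  ⋁-event : ∀ n {A : Fin (suc n) → T} → (∀ i → IsEvent (A i)) → IsEvent (⋁ n A)
  ⋁-event zero    eA = eA Fin.zero
  ⋁-event (suc n) eA = ∨-event (eA Fin.zero) (⋁-event n (λ i → eA (Fin.suc i)))

  module Plausible {ℓ : Level} (P : PlausiblePreorder ℓ) where
    open PlausiblePreorder P

    ≲-refl : ∀ X → X ≲ X
    ≲-refl X = ≲-iff-r X X (subst (𝟎 ≲_) (sym (x−x≡𝟎 X)) (event-nonneg 𝟎 𝟎-event))

    ∨-≲-+ : ∀ {A B S} → IsEvent A → IsEvent B → B ≲ S → (A ∨ B) ≲ (A + S)
    ∨-≲-+ {A} {B} {S} eA eB B≲S = ≲-iff-r (A ∨ B) (A + S)
      (subst (𝟎 ≲_) (sym ([A+S]−[A∨B]≡[S−B]+A∙B A S B))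
        (add-nonneg (S − B) (A ∙ B) (≲-iff-l B S B≲S) (event-nonneg (A ∙ B) (∙-event eA eB))))

    ⋁≲∑ : ∀ n {A : Fin (suc n) → T} → (∀ i → IsEvent (A i)) → ⋁ n A ≲ ∑ n A
    ⋁≲∑ zero    {A} eA = ≲-refl (A Fin.zero)
    ⋁≲∑ (suc n) {A} eA = ∨-≲-+ (eA Fin.zero) (⋁-event n eA′) (⋁≲∑ n eA′)
      where
      eA′ : ∀ i → IsEvent (A (Fin.suc i))
      eA′ i = eA (Fin.suc i)

mainTheorem19 : ∀ {a t ℓ : Level} (K : Scalars a) (𝒯 : Algebra K t)
                → (P : Algebra.PlausiblePreorder 𝒯 ℓ)
                → (n : ℕ) (A : Fin (suc n) → Algebra.T 𝒯)
                → (∀ i → Algebra.IsEvent 𝒯 (A i))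
                → Algebra.PlausiblePreorder._≲_ P (Algebra.⋁ 𝒯 n A) (Algebra.∑ 𝒯 n A)
mainTheorem19 K 𝒯 P n A = Events.Plausible.⋁≲∑ 𝒯 P n
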